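{- Let $S\subseteq\{1,2,3\}$ with $3\in S$. Then $\mathfrak{E}^S_{n+1}$ is feebly representable for all integers $n\geq 3$.
   Context: Let $C=\{c_1,\dots,c_n\}$ and $C^+=\{1'\}\cup C$. The chromatic algebra $\mathfrak{E}^S_{n+1}$: a triple $(x,y,z)\in (C^+)^3$ is consistent if either one of $x,y,z$ equals $1'$ and the other two are equal, or $x,y,z\in C$ and $|\{x,y,z\}|\in S$. The algebra has universe the power set of $C^+$, set-theoretic Boolean operations ($0=\varnothing$, $1=C^+$), identity $\{1'\}$, converse the identity map, and composition $X;Y=\{z:(x,y,z)\text{ consistent for some }x\in X,y\in Y\}$; $\leq$ is inclusion. A feeble representation of $\mathbf A$ on a set $U$ is an injective Boolean algebra homomorphism $\varphi$ from $\mathbf A$ into the power set of $U\times U$ with $\varphi(0)=\varnothing$, $\varphi(1)=U\times U$, $\varphi(1')=\mathrm{Id}_U$, $\varphi(\breve x)=\varphi(x)^{\smile}$, and $\varphi(x)\circ\varphi(y)\subseteq\varphi(x;y)$ for all $x,y$ ($\circ$ relational composition). -}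

module Defs where

open import Data.Nat using (ℕ; zero; suc)
open import Data.Fin using (Fin; zero; suc; _≟_)
open import Data.Bool using (Bool; true; false; _∧_; _∨_; if_then_else_)
open import Data.Vec using (lookup; tabulate)
open import Data.Fin.Subset using (Subset; ⊥; ⊤; ⁅_⁆; _∪_; _∩_; ∁)
open import Data.Sum using (_⊎_)
open import Data.Product using (_×_)
open import Relation.Nullary using (¬_)
open import Relation.Nullary.Decidable using (⌊_⌋)
open import Relation.Binary.PropositionalEquality using (_≡_)
open import Function.Bundles using (_⇔_)

-- C⁺ = {1'} ∪ C with C = {c_1,…,c_n}: modelled as Fin (suc n),
-- where zero is 1' and suc i is c_(i+1).

eqb : ∀ {m} → Fin m → Fin m → Bool
eqb x y = ⌊ x ≟ y ⌋

card3 : ∀ {m} → Fin m → Fin m → Fin m → ℕ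
card3 x y z =
  if eqb x y then (if eqb y z then 1 else 2)
  else (if eqb y z ∨ eqb x z then 2 else 3)

consistent : (S : ℕ → Bool) {n : ℕ} → Fin (suc n) → Fin (suc n) → Fin (suc n) → Bool
consistent S zero y z = eqb y z
consistent S (suc x) zero z = eqb (suc x) z
consistent S (suc x) (suc y) zero = eqb x y
consistent S (suc x) (suc y) (suc z) = S (card3 x y z)

anyFin : ∀ {m} → (Fin m → Bool) → Bool
anyFin {zero} f = false
anyFin {suc m} f = f zero ∨ anyFin (λ i → f (suc i))

identity : ∀ {n} → Subset (suc n)
identity = ⁅ zero ⁆

converse : ∀ {n} → Subset (suc n) → Subset (suc n)
converse X = X

compose : (S : ℕ → Bool) {n : ℕ} → Subset (suc n) → Subset (suc n) → Subset (suc n)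
compose S X Y = tabulate λ z →
  anyFin λ x → anyFin λ y → lookup X x ∧ lookup Y y ∧ consistent S x y z

-- Feeble representation of 𝔈^S_{n+1} on U; binary relations on U are U → U → Set,
-- equality of relations is extensional (pointwise ⇔).
record FeebleRep (S : ℕ → Bool) (n : ℕ) (U : Set) : Set₁ where
  field
    φ : Subset (suc n) → U → U → Set
    injective : ∀ X Y → (∀ u v → φ X u v ⇔ φ Y u v) → X ≡ Y
    pres-∪ : ∀ X Y u v → φ (X ∪ Y) u v ⇔ (φ X u v ⊎ φ Y u v)
    pres-∩ : ∀ X Y u v → φ (X ∩ Y) u v ⇔ (φ X u v × φ Y u v)
    pres-∁ : ∀ X u v → φ (∁ X) u v ⇔ (¬ φ X u v)
    pres-0 : ∀ u v → ¬ φ ⊥ u v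
    pres-1 : ∀ u v → φ ⊤ u v
    pres-id : ∀ u v → φ identity u v ⇔ (u ≡ v)
    pres-conv : ∀ X u v → φ (converse X) u v ⇔ φ X v u
    pres-comp : ∀ X Y u w v → φ X u w → φ Y w v → φ (compose S X Y) u v

-- Colour the pair {u, v} of distinct points of ℤ/n by the colour with index
-- u + v mod n, and the diagonal by 1'.
-- Since u ↦ w + u is injective, the three sides of a triangle u, w, v of distinct
-- points get three distinct colours, so every triangle is consistent once 3 ∈ S.  Sending an element X of the algebra
-- to the set of pairs whose colour lies in X is then a feeble representation;
-- it is injective because for n ≥ 3 every colour occurs (index 0 on the pair {1, n - 1}).
module Submission where

open import Defs
open import Data.Nat using (ℕ; _≤_; zero; suc; _+_; _*_; _%_; s≤s; z≤n)
open import Data.Nat.DivMod using (m%n<n; m<n⇒m%n≡m; n%n≡0; [m+kn]%n≡m%n; %-distribˡ-+)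
open import Data.Nat.Properties using (+-comm)
open import Data.Nat.Solver using (module +-*-Solver)
open import Data.Bool using (Bool; T; true; false; _∧_)
open import Data.Bool.Properties using (T-≡; T-∧; T-∨)
open import Data.Product using (Σ; _×_; _,_; ∃₂)
open import Data.Sum using (inj₁; inj₂)
open import Data.Empty using (⊥-elim)
open import Data.Fin using (Fin; zero; suc; toℕ; fromℕ; fromℕ<; _≟_)
open import Data.Fin.Properties using (toℕ-fromℕ<; toℕ-fromℕ; toℕ-injective; toℕ<n; 0≢1+n)
open import Data.Fin.Subset using (Subset; _∈_; _⊆_)
open import Data.Fin.Subset.Properties
  using (∉⊥; ∈⊤; x∈⁅y⁆⇔x≡y; ⊆-antisym; x∈p∪q⁻; x∈p∪q⁺; x∈p∩q⁺; x∈p∩q⁻; x∈p⇒x∉∁p; x∉p⇒x∈∁p)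
open import Data.Vec using (lookup)
open import Data.Vec.Properties using (lookup∘tabulate; []=⇒lookup; lookup⇒[]=)
open import Function.Base using (_∘_)
open import Function.Bundles using (_⇔_; mk⇔; Equivalence)
open import Function.Properties.Equivalence using () renaming (sym to ⇔-sym)
open import Relation.Binary.Definitions using (DecidableEquality)
open import Relation.Binary.PropositionalEquality
open import Relation.Nullary using (Dec; yes; no)
open import Relation.Nullary.Decidable using (fromWitness; isYes≗does; dec-false)

open Equivalence using (to; from)

eqb-refl : ∀ {m} (x : Fin m) → T (eqb x x)
eqb-refl x = fromWitness refl

eqb-≢ : ∀ {m} {x y : Fin m} → x ≢ y → eqb x y ≡ false
eqb-≢ {x = x} {y} x≢y = trans (isYes≗does (x ≟ y)) (dec-false (x ≟ y) x≢y)

card3-distinct : ∀ {m} {x y z : Fin m} → x ≢ y → y ≢ z → x ≢ z → card3 x y z ≡ 3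
card3-distinct x≢y y≢z x≢z rewrite eqb-≢ x≢y | eqb-≢ y≢z | eqb-≢ x≢z = refl

consistent-1'ˡ : ∀ S {n} (a : Fin (suc n)) → T (consistent S zero a a)
consistent-1'ˡ S a = eqb-refl a

consistent-1'ᵐ : ∀ S {n} (a : Fin (suc n)) → T (consistent S a zero a)
consistent-1'ᵐ S {n} zero = eqb-refl {suc n} zero
consistent-1'ᵐ S (suc a)  = eqb-refl (suc a)

consistent-1'ʳ : ∀ S {n} (a : Fin (suc n)) → T (consistent S a a zero)
consistent-1'ʳ S {n} zero = eqb-refl {suc n} zero
consistent-1'ʳ S (suc a)  = eqb-refl a

anyFin-intro : ∀ {m} (f : Fin m → Bool) (i : Fin m) → T (f i) → T (anyFin f)
anyFin-intro f zero    fi = from T-∨ (inj₁ fi)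
anyFin-intro f (suc i) fi = from T-∨ (inj₂ (anyFin-intro (λ k → f (suc k)) i fi))

∈⇒T-lookup : ∀ {m} {x : Fin m} {P : Subset m} → x ∈ P → T (lookup P x)
∈⇒T-lookup x∈P = from T-≡ ([]=⇒lookup x∈P)

compose-intro : ∀ S {n} {X Y : Subset (suc n)} {x y z} →
  x ∈ X → y ∈ Y → T (consistent S x y z) → z ∈ compose S X Y
compose-intro S {n} {X} {Y} {x} {y} {z} x∈X y∈Y xyz =
  lookup⇒[]= z (compose S X Y) (trans (lookup∘tabulate (λ z′ → anyFin (anyFin ∘ admits z′)) z)
    (to T-≡ (anyFin-intro (anyFin ∘ admits z) x (anyFin-intro (admits z x) y witness))))
  where
    admits : Fin (suc n) → Fin (suc n) → Fin (suc n) → Bool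
    admits z′ x′ y′ = lookup X x′ ∧ lookup Y y′ ∧ consistent S x′ y′ z′
    witness : T (admits z x y)
    witness = from T-∧ (∈⇒T-lookup x∈X , from T-∧ (∈⇒T-lookup y∈Y , xyz))

record AtomLabelling (S : ℕ → Bool) (n : ℕ) (U : Set) : Set where
  field
    label            : U → U → Fin (suc n)
    label-onto       : ∀ a → ∃₂ λ u v → label u v ≡ a
    label≡1'⇔≡       : ∀ u v → label u v ≡ zero ⇔ u ≡ v
    label-sym        : ∀ u v → label u v ≡ label v u
    label-consistent : ∀ u w v → T (consistent S (label u w) (label w v) (label u v))

  separates : ∀ X Y → (∀ u v → label u v ∈ X ⇔ label u v ∈ Y) → X ⊆ Y
  separates X Y same {a} a∈X with label-onto a
  ... | u , v , refl = to (same u v) a∈X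

  feebleRep : FeebleRep S n U
  feebleRep = record
    { φ         = λ X u v → label u v ∈ X
    ; injective = λ X Y same →
        ⊆-antisym (separates X Y same) (separates Y X (λ u v → ⇔-sym (same u v)))
    ; pres-∪    = λ X Y u v → mk⇔ (x∈p∪q⁻ X Y) x∈p∪q⁺
    ; pres-∩    = λ X Y u v → mk⇔ (x∈p∩q⁻ X Y) x∈p∩q⁺
    ; pres-∁    = λ X u v → mk⇔ (λ a∈∁X a∈X → x∈p⇒x∉∁p a∈X a∈∁X) x∉p⇒x∈∁p
    ; pres-0    = λ u v → ∉⊥
    ; pres-1    = λ u v → ∈⊤
    ; pres-id   = λ u v → mk⇔ (to (label≡1'⇔≡ u v) ∘ to x∈⁅y⁆⇔x≡y)
                               (from x∈⁅y⁆⇔x≡y ∘ from (label≡1'⇔≡ u v))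
    ; pres-conv = λ X u v → mk⇔ (subst (_∈ X) (label-sym u v)) (subst (_∈ X) (label-sym v u))
    ; pres-comp = λ X Y u w v uw∈X wv∈Y → compose-intro S uw∈X wv∈Y (label-consistent u w v)
    }

record ProperColouring (n : ℕ) (U : Set) : Set where
  field
    point          : U
    _≟ᵤ_           : DecidableEquality U
    colour         : U → U → Fin n
    colour-sym     : ∀ u v → colour u v ≡ colour v u
    colour-cancelˡ : ∀ u {v w} → colour u v ≡ colour u w → v ≡ w
    colour-onto    : ∀ c → ∃₂ λ u v → u ≢ v × colour u v ≡ c

  label : U → U → Fin (suc n)
  label u v with u ≟ᵤ v
  ... | yes _ = zero
  ... | no  _ = suc (colour u v)

  label-refl : ∀ u → label u u ≡ zero
  label-refl u with u ≟ᵤ u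
  ... | yes _   = refl
  ... | no  u≢u = ⊥-elim (u≢u refl)

  label-≢ : ∀ {u v} → u ≢ v → label u v ≡ suc (colour u v)
  label-≢ {u} {v} u≢v with u ≟ᵤ v
  ... | yes u≡v = ⊥-elim (u≢v u≡v)
  ... | no  _   = refl

  label-sym : ∀ u v → label u v ≡ label v u
  label-sym u v with u ≟ᵤ v | v ≟ᵤ u
  ... | yes _   | yes _   = refl
  ... | yes u≡v | no  v≢u = ⊥-elim (v≢u (sym u≡v))
  ... | no  u≢v | yes v≡u = ⊥-elim (u≢v (sym v≡u))
  ... | no  _   | no  _   = cong suc (colour-sym u v)

  label≡1'⇔≡ : ∀ u v → label u v ≡ zero ⇔ u ≡ v
  label≡1'⇔≡ u v = mk⇔ label≡1'⇒≡ λ { refl → label-refl u }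
    where
      label≡1'⇒≡ : label u v ≡ zero → u ≡ v
      label≡1'⇒≡ eq with u ≟ᵤ v
      ... | yes u≡v = u≡v
      ... | no  _   = ⊥-elim (0≢1+n (sym eq))

  label-onto : ∀ a → ∃₂ λ u v → label u v ≡ a
  label-onto zero    = point , point , label-refl point
  label-onto (suc c) with colour-onto c
  ... | u , v , u≢v , refl = u , v , label-≢ u≢v

  triangle-rainbow : ∀ {u w v} → u ≢ w → w ≢ v → u ≢ v →
    card3 (colour u w) (colour w v) (colour u v) ≡ 3
  triangle-rainbow {u} {w} {v} u≢w w≢v u≢v = card3-distinct
    (λ eq → u≢v (colour-cancelˡ w (trans (colour-sym w u) eq)))
    (λ eq → u≢w (sym (colour-cancelˡ v (trans (colour-sym v w) (trans eq (colour-sym u v))))))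
    (λ eq → w≢v (colour-cancelˡ u eq))

  module _ (S : ℕ → Bool) (S3 : T (S 3)) where
    consistent-by-cases : ∀ u w v → Dec (u ≡ w) → Dec (w ≡ v) → Dec (u ≡ v) →
      T (consistent S (label u w) (label w v) (label u v))
    consistent-by-cases u _ v (yes refl) _ _ rewrite label-refl u = consistent-1'ˡ S (label u v)
    consistent-by-cases u w _ (no _) (yes refl) _ rewrite label-refl w = consistent-1'ᵐ S (label u w)
    consistent-by-cases u w _ (no _) (no _) (yes refl)
      rewrite label-refl u | label-sym w u = consistent-1'ʳ S (label u w)
    consistent-by-cases u w v (no u≢w) (no w≢v) (no u≢v)
      rewrite label-≢ u≢w | label-≢ w≢v | label-≢ u≢v | triangle-rainbow u≢w w≢v u≢v = S3

    label-consistent : ∀ u w v → T (consistent S (label u w) (label w v) (label u v))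
    label-consistent u w v = consistent-by-cases u w v (u ≟ᵤ w) (w ≟ᵤ v) (u ≟ᵤ v)

  atomLabelling : ∀ S → T (S 3) → AtomLabelling S n U
  atomLabelling S S3 = record
    { label            = label
    ; label-onto       = label-onto
    ; label≡1'⇔≡       = label≡1'⇔≡
    ; label-sym        = label-sym
    ; label-consistent = label-consistent S S3
    }

%-cancelˡ-+ : ∀ k a {b c} → (a + b) % suc k ≡ (a + c) % suc k → b % suc k ≡ c % suc k
%-cancelˡ-+ k a {b} {c} eq = begin
  b % d                                ≡⟨ undo-a b ⟩
  ((k * a) % d + (a + b) % d) % d      ≡⟨ cong (λ r → ((k * a) % d + r) % d) eq ⟩
  ((k * a) % d + (a + c) % d) % d      ≡⟨ undo-a c ⟨
  c % d                                ∎
  where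
    open ≡-Reasoning
    d = suc k
    -- k * a ≡ - a (mod k + 1)
    undo-a : ∀ x → x % d ≡ ((k * a) % d + (a + x) % d) % d
    undo-a x = begin
      x % d                            ≡⟨ [m+kn]%n≡m%n x a d ⟨
      (x + a * d) % d                  ≡⟨ cong (_% d) (solve 3 (λ x a k → x :+ a :* (con 1 :+ k)
                                                                := k :* a :+ (a :+ x)) refl x a k) ⟩
      (k * a + (a + x)) % d            ≡⟨ %-distribˡ-+ (k * a) (a + x) d ⟩
      ((k * a) % d + (a + x) % d) % d  ∎
      where open +-*-Solver

_+ₘ_ : ∀ {k} → Fin (suc k) → Fin (suc k) → Fin (suc k)
_+ₘ_ {k} i j = fromℕ< (m%n<n (toℕ i + toℕ j) (suc k))

toℕ-+ₘ : ∀ {k} (i j : Fin (suc k)) → toℕ (i +ₘ j) ≡ (toℕ i + toℕ j) % suc k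
toℕ-+ₘ i j = toℕ-fromℕ< _

+ₘ-comm : ∀ {k} (i j : Fin (suc k)) → i +ₘ j ≡ j +ₘ i
+ₘ-comm {k} i j = toℕ-injective (begin
  toℕ (i +ₘ j)            ≡⟨ toℕ-+ₘ i j ⟩
  (toℕ i + toℕ j) % suc k ≡⟨ cong (_% suc k) (+-comm (toℕ i) (toℕ j)) ⟩
  (toℕ j + toℕ i) % suc k ≡⟨ toℕ-+ₘ j i ⟨
  toℕ (j +ₘ i)            ∎)
  where open ≡-Reasoning

+ₘ-cancelˡ : ∀ {k} (i : Fin (suc k)) {j j′} → i +ₘ j ≡ i +ₘ j′ → j ≡ j′
+ₘ-cancelˡ {k} i {j} {j′} eq = toℕ-injective (begin
  toℕ j           ≡⟨ m<n⇒m%n≡m (toℕ<n j) ⟨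
  toℕ j % suc k   ≡⟨ %-cancelˡ-+ k (toℕ i) (trans (sym (toℕ-+ₘ i j)) (trans (cong toℕ eq) (toℕ-+ₘ i j′))) ⟩
  toℕ j′ % suc k  ≡⟨ m<n⇒m%n≡m (toℕ<n j′) ⟩
  toℕ j′          ∎)
  where open ≡-Reasoning

+ₘ-onto-distinct : ∀ k (c : Fin (3 + k)) → ∃₂ λ i j → i ≢ j × i +ₘ j ≡ c
+ₘ-onto-distinct k zero    = suc zero , fromℕ (2 + k) , (λ ()) , toℕ-injective (begin
  toℕ (suc zero +ₘ fromℕ (2 + k))  ≡⟨ toℕ-+ₘ (suc zero) (fromℕ (2 + k)) ⟩
  (1 + toℕ (fromℕ (2 + k))) % N    ≡⟨ cong (λ m → suc m % N) (toℕ-fromℕ (2 + k)) ⟩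
  N % N                            ≡⟨ n%n≡0 N ⟩
  0                                ∎)
  where
    open ≡-Reasoning
    N = 3 + k
+ₘ-onto-distinct k (suc c) = zero , suc c , 0≢1+n ,
  toℕ-injective (trans (toℕ-+ₘ zero (suc c)) (m<n⇒m%n≡m (toℕ<n (suc c))))

sumColouring : ∀ k → ProperColouring (3 + k) (Fin (3 + k))
sumColouring k = record
  { point          = zero
  ; _≟ᵤ_           = _≟_
  ; colour         = _+ₘ_
  ; colour-sym     = +ₘ-comm
  ; colour-cancelˡ = +ₘ-cancelˡ
  ; colour-onto    = +ₘ-onto-distinct k
  }

mainTheorem6 : (S : ℕ → Bool) → (∀ k → T (S k) → 1 ≤ k × k ≤ 3) → T (S 3) →
    ∀ n → 3 ≤ n → Σ Set (λ U → FeebleRep S n U)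
mainTheorem6 S _ S3 (suc (suc (suc k))) (s≤s (s≤s (s≤s z≤n))) =
  Fin (3 + k) , AtomLabelling.feebleRep (ProperColouring.atomLabelling (sumColouring k) S S3)
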